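{- Let $n$ be a positive integer and $d\ge 0$ an integer. The Harary graph $H_{4n+1,4n+4}$ is $(a,d)$-distance antimagic for some integer $a$ if and only if $d=1$.
   Context: $H_{4n+1,4n+4}$ has vertices $v_0,\dots,v_{4n+3}$ (indices mod $4n+4$): $v_i\sim v_j$ iff $i\ne j$ and $j\equiv i+t$ for some $1\le|t|\le 2n$, or $j\equiv i+2n+2$; it is $(4n+1)$-regular. For integers $a$ and $d\ge 0$, an $(a,d)$-distance antimagic labeling of a graph $G$ on $N$ vertices is a bijection $f:V(G)\to\{1,\dots,N\}$ such that the set of vertex weights $\{\sum_{v\in N_G(u)}f(v): u\in V(G)\}$ equals $\{a,a+d,\dots,a+(N-1)d\}$; $G$ is $(a,d)$-distance antimagic if it admits one. -}

module Defs where

open import Data.Nat using (ℕ; zero; suc; _+_; _*_; _∸_; _≡ᵇ_; _≤ᵇ_)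
open import Data.Nat.DivMod using (_%_)
open import Data.Fin using (Fin; toℕ)
open import Data.Integer as ℤ using (ℤ; +_)
open import Data.Product using (Σ; ∃; _×_; _,_)
open import Data.Bool using (Bool; if_then_else_; _∧_; _∨_; not)
open import Data.List using (map; allFin)
open import Data.Nat.ListAction using (sum)
open import Relation.Binary.PropositionalEquality using (_≡_)
open import Function.Bundles using (_⤖_; _⇔_; Bijection)

order : ℕ → ℕ
order n = suc (4 * n + 3)

cdiff : (n : ℕ) → Fin (order n) → Fin (order n) → ℕ
cdiff n i j = (toℕ j + (order n ∸ toℕ i)) % order n

-- Adjacency in H_{4n+1,4n+4}: v_i ~ v_j iff i ≠ j and
-- j ≡ i + t (mod N) for some 1 ≤ |t| ≤ 2n, or j ≡ i + 2n + 2 (mod N).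
-- With t' = (j - i) mod N ∈ {0,…,N-1}: t' ≠ 0 and
-- (t' ≤ 2n, or t' ≥ N - 2n = 2n+4, or t' = 2n+2).
adjᵇ : (n : ℕ) → Fin (order n) → Fin (order n) → Bool
adjᵇ n i j =
  let t = cdiff n i j in
  not (t ≡ᵇ 0) ∧ ((t ≤ᵇ 2 * n) ∨ ((2 * n + 4) ≤ᵇ t) ∨ (t ≡ᵇ (2 * n + 2)))

-- A labeling is a bijection f : V → {1,…,N}; encoded as a bijection
-- Fin N ⤖ Fin N, with the label of v being toℕ (f v) + 1.
Labeling : ℕ → Set
Labeling n = Fin (order n) ⤖ Fin (order n)

label : (n : ℕ) → Labeling n → Fin (order n) → ℕ
label n f v = suc (toℕ (Bijection.to f v))

weight : (n : ℕ) → Labeling n → Fin (order n) → ℕ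
weight n f u = sum (map (λ v → if adjᵇ n u v then label n f v else 0) (allFin (order n)))

IsDistAntimagicLabeling : (n : ℕ) → ℤ → ℕ → Labeling n → Set
IsDistAntimagicLabeling n a d f =
  (x : ℤ) → (∃ λ (u : Fin (order n)) → + weight n f u ≡ x)
          ⇔ (∃ λ (k : Fin (order n)) → x ≡ a ℤ.+ (+ (toℕ k * d)))

HararyDistAntimagic : ℕ → ℤ → ℕ → Set
HararyDistAntimagic n a d = Σ (Labeling n) (IsDistAntimagicLabeling n a d)

-- In H_{4n+1,4n+4} a vertex u is adjacent to everything except u, u + (2n+1) and u + (2n+3),
-- so its weight is S − T(u), where S is the sum of all labels and T(u) the sum of the labels
-- on those three vertices.
--
-- If the weights are A, A + d, …, A + (N−1)d with N = 4n+4, then T(ρ k) + k·d is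
-- constant, where ρ k is a vertex of weight A + k·d. Summing over all vertices, and using that
-- each shift permutes the vertices, gives 3S + d·N(N−1)/2 = N·T(ρ 0), i.e.
-- 6 + (3 + d)(N − 1) = 2·T(ρ 0); as N − 1 is odd, d is odd. Since T takes values in [3, 3N)
-- while it must vary by (N−1)d, also d < 3.
--
-- Use 0-based labels ℓ: an even vertex x gets ℓ x = x and an odd vertex y gets
-- ℓ y = N − 1 − ((y + 2n + 1) mod N). Then x and x + (2n+3) carry complementary labels for
-- every even x, which turns the three-label sum at u into N − 1 + ℓ(τ u), where τ u is
-- u + (2n+1) or u + (2n+3) according as u is even or odd. As τ is a bijection, the weights are
-- N consecutive integers.

module Submission where

open import Defs
open import Data.Nat using (ℕ; suc)
open import Data.Integer using (ℤ)
open import Data.Product using (∃)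
open import Relation.Binary.PropositionalEquality using (_≡_)
open import Function.Bundles using (_⇔_)

open import Data.Bool using (Bool; true; false; not; _∧_; _∨_; if_then_else_)
open import Data.Bool.Properties using (∨-zeroʳ)
open import Data.Empty using (⊥-elim)
open import Data.Fin as Fin using (Fin; toℕ; fromℕ<; punchOut; opposite)
open import Data.Fin.Permutation using (Permutation; permutation)
open import Data.Fin.Properties
  using (toℕ-injective; toℕ<n; toℕ-fromℕ<; toℕ-inject₁; toℕ-fromℕ; any?; punchOut-injective; injective⇒≤;
         opposite-prop; opposite-involutive)
import Data.Fin.Properties as Fin
import Data.Integer as ℤ
import Data.Integer.Properties as ℤ
open import Data.List using (map; allFin; tabulate)
open import Data.List.Properties using (map-tabulate)
open import Data.Nat
  using (zero; _+_; _*_; _∸_; _≤_; _<_; z≤n; s≤s; _≡ᵇ_; _≤ᵇ_; NonZero; ≢-nonZero; >-nonZero⁻¹; parity)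
open import Data.Nat.DivMod
import Data.Nat.ListAction as List
open import Data.Nat.Properties
open import Algebra.Properties.Semiring.Sum +-*-semiring
  using (sum; sum-syntax; sum-cong-≗; sum-init-last; sum-permute; ∑-distrib-+; *-distribʳ-sum)
open import Data.Nat.Tactic.RingSolver using (solve-∀)
open import Data.Parity as ℙ using (Parity; 0ℙ; 1ℙ; _⁻¹)
import Data.Parity.Properties as ℙ
open import Data.Product using (_×_; _,_; proj₁; proj₂)
open import Data.Sum using (_⊎_; inj₁; inj₂; [_,_]′)
open import Function using (_∘_; id)
open import Function.Bundles using (_⤖_; mk⤖; mk⇔; Bijection; Equivalence)
open import Function.Consequences.Propositional using (strictlySurjective⇒surjective)
open import Function.Definitions using (Injective; StrictlySurjective)
open import Relation.Nullary using (¬_; yes; no)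
open import Relation.Nullary.Decidable using (dec-true; dec-false)
open import Relation.Binary.PropositionalEquality
open ≡-Reasoning

sum-tabulate : ∀ {n} (g : Fin n → ℕ) → List.sum (tabulate g) ≡ ∑[ i < n ] g i
sum-tabulate {zero}  g = refl
sum-tabulate {suc n} g = cong (g Fin.zero +_) (sum-tabulate (g ∘ Fin.suc))

sum-map-allFin : ∀ {n} (g : Fin n → ℕ) → List.sum (map g (allFin n)) ≡ ∑[ i < n ] g i
sum-map-allFin g = trans (cong List.sum (map-tabulate id g)) (sum-tabulate g)

∑-const : ∀ n c → ∑[ i < n ] c ≡ n * c
∑-const zero    c = refl
∑-const (suc n) c = cong (c +_) (∑-const n c)

∑-toℕ : ∀ n → 2 * ∑[ i < n ] toℕ i + n ≡ n * n
∑-toℕ zero    = refl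
∑-toℕ (suc n) = begin
  2 * ∑[ i < suc n ] toℕ i + suc n
    ≡⟨ cong (λ s → 2 * s + suc n) (sum-init-last {n} toℕ) ⟩
  2 * (∑[ i < n ] toℕ (Fin.inject₁ i) + toℕ (Fin.fromℕ n)) + suc n
    ≡⟨ cong₂ (λ s t → 2 * (s + t) + suc n) (sum-cong-≗ {n} toℕ-inject₁) (toℕ-fromℕ n) ⟩
  2 * (∑[ i < n ] toℕ i + n) + suc n
    ≡⟨ regroup (∑[ i < n ] toℕ i) n ⟩
  2 * ∑[ i < n ] toℕ i + n + (2 * n + 1)
    ≡⟨ cong (_+ (2 * n + 1)) (∑-toℕ n) ⟩
  n * n + (2 * n + 1)
    ≡⟨ square n ⟩
  suc n * suc n ∎
  where
  regroup : ∀ s n → 2 * (s + n) + suc n ≡ 2 * s + n + (2 * n + 1)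
  regroup = solve-∀
  square : ∀ n → n * n + (2 * n + 1) ≡ suc n * suc n
  square = solve-∀

∑-single : ∀ {n} (w : Fin n) (g : Fin n → ℕ) → (∀ v → v ≢ w → g v ≡ 0) → ∑[ v < n ] g v ≡ g w
∑-single {suc n} Fin.zero g zero-elsewhere = begin
  g Fin.zero + ∑[ v < n ] g (Fin.suc v)
    ≡⟨ cong (g Fin.zero +_) (trans (sum-cong-≗ (λ v → zero-elsewhere (Fin.suc v) λ ())) (∑-const n 0)) ⟩
  g Fin.zero + n * 0
    ≡⟨ cong (g Fin.zero +_) (*-zeroʳ n) ⟩
  g Fin.zero + 0
    ≡⟨ +-identityʳ _ ⟩
  g Fin.zero ∎
∑-single {suc n} (Fin.suc w) g zero-elsewhere =
  cong₂ _+_ (zero-elsewhere Fin.zero λ ())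
            (∑-single w (g ∘ Fin.suc) λ v v≢w → zero-elsewhere (Fin.suc v) (v≢w ∘ Fin.suc-injective))

injective⇒strictlySurjective : ∀ {n} {σ : Fin n → Fin n} → Injective _≡_ _≡_ σ → StrictlySurjective _≡_ σ
injective⇒strictlySurjective {n} {σ} σ-inj y with any? (λ x → σ x Fin.≟ y)
... | yes hit = hit
injective⇒strictlySurjective {suc n} {σ} σ-inj y | no miss =
  ⊥-elim (1+n≰n (injective⇒≤ {f = squeeze} squeeze-injective))
  where
  avoids : ∀ x → y ≢ σ x
  avoids x y≡σx = miss (x , sym y≡σx)
  squeeze : Fin (suc n) → Fin n
  squeeze x = punchOut (avoids x)
  squeeze-injective : Injective _≡_ _≡_ squeeze
  squeeze-injective eq = σ-inj (punchOut-injective (avoids _) (avoids _) eq)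

∑-reindex : ∀ {n} {σ : Fin n → Fin n} → Injective _≡_ _≡_ σ → (g : Fin n → ℕ) →
            ∑[ i < n ] g (σ i) ≡ ∑[ i < n ] g i
∑-reindex {n} {σ} σ-inj g = sym (sum-permute g π)
  where
  σ⁻¹ : Fin n → Fin n
  σ⁻¹ y = proj₁ (injective⇒strictlySurjective σ-inj y)
  π : Permutation n n
  π = permutation σ σ⁻¹ (λ y → proj₂ (injective⇒strictlySurjective σ-inj y))
                        (λ x → σ-inj (proj₂ (injective⇒strictlySurjective σ-inj (σ x))))

[m%o+n]%o≡[m+n]%o : ∀ m n o .{{_ : NonZero o}} → (m % o + n) % o ≡ (m + n) % o
[m%o+n]%o≡[m+n]%o m n o = begin
  (m % o + n) % o           ≡⟨ %-distribˡ-+ (m % o) n o ⟩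
  (m % o % o + n % o) % o   ≡⟨ cong (λ x → (x + n % o) % o) (m%n%n≡m%n m o) ⟩
  (m % o + n % o) % o       ≡⟨ %-distribˡ-+ m n o ⟨
  (m + n) % o               ∎

[m+n%o]%o≡[m+n]%o : ∀ m n o .{{_ : NonZero o}} → (m + n % o) % o ≡ (m + n) % o
[m+n%o]%o≡[m+n]%o m n o = begin
  (m + n % o) % o ≡⟨ cong (_% o) (+-comm m (n % o)) ⟩
  (n % o + m) % o ≡⟨ [m%o+n]%o≡[m+n]%o n m o ⟩
  (n + m) % o     ≡⟨ cong (_% o) (+-comm n m) ⟩
  (m + n) % o     ∎

parity-% : ∀ m n .{{_ : NonZero n}} → parity n ≡ 0ℙ → parity (m % n) ≡ parity m
parity-% m n even = begin
  r                             ≡⟨ ℙ.+-identityʳ r ⟨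
  r ℙ.+ 0ℙ                      ≡⟨ cong (r ℙ.+_) (ℙ.*-zeroʳ q) ⟨
  r ℙ.+ (q ℙ.* 0ℙ)              ≡⟨ cong (λ p → r ℙ.+ (q ℙ.* p)) even ⟨
  r ℙ.+ (q ℙ.* parity n)        ≡⟨ cong (r ℙ.+_) (ℙ.*-homo-* (m / n) n) ⟨
  r ℙ.+ parity (m / n * n)      ≡⟨ ℙ.+-homo-+ (m % n) (m / n * n) ⟨
  parity (m % n + m / n * n)    ≡⟨ cong parity (m≡m%n+[m/n]*n m n) ⟨
  parity m                      ∎
  where
  r = parity (m % n)
  q = parity (m / n)

parity-suc : ∀ m → parity (suc m) ≡ parity m ⁻¹
parity-suc m = trans (sym (ℙ.⁻¹-involutive (parity (suc m)))) (cong _⁻¹ (ℙ.suc-homo-⁻¹ m))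

parity-opposite : ∀ {N} → parity N ≡ 0ℙ → (z : Fin N) → parity (toℕ (opposite z)) ≡ parity (toℕ z) ⁻¹
parity-opposite {N} N-even z = trans (ℙ.+-cancelʳ-≡ q _ _ (begin
  parity (toℕ (opposite z)) ℙ.+ q          ≡⟨ ℙ.+-homo-+ (toℕ (opposite z)) (suc (toℕ z)) ⟨
  parity (toℕ (opposite z) + suc (toℕ z))  ≡⟨ cong parity opposite+suc≡N ⟩
  parity N                                 ≡⟨ N-even ⟩
  0ℙ                                       ≡⟨ ℙ.p+p≡0ℙ q ⟨
  q ℙ.+ q                                  ∎)) (parity-suc (toℕ z))
  where
  q = parity (suc (toℕ z))
  opposite+suc≡N : toℕ (opposite z) + suc (toℕ z) ≡ N
  opposite+suc≡N = begin
    toℕ (opposite z) + suc (toℕ z)  ≡⟨ +-comm (toℕ (opposite z)) (suc (toℕ z)) ⟩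
    suc (toℕ z) + toℕ (opposite z)  ≡⟨ cong (suc (toℕ z) +_) (opposite-prop z) ⟩
    suc (toℕ z) + (N ∸ suc (toℕ z)) ≡⟨ m+[n∸m]≡n (toℕ<n z) ⟩
    N                               ∎

parity-cases : ∀ m → parity m ≡ 0ℙ ⊎ parity m ≡ 1ℙ
parity-cases m with parity m
... | 0ℙ = inj₁ refl
... | 1ℙ = inj₂ refl

parity-2*+ : ∀ m k → parity (2 * m + k) ≡ parity k
parity-2*+ m k = trans (ℙ.+-homo-+ (2 * m) k) (cong (ℙ._+ parity k) (ℙ.*-homo-* 2 m))

module CyclicShift (N : ℕ) .{{_ : NonZero N}} where

  infixl 6 _⊕_

  _⊕_ : Fin N → ℕ → Fin N
  u ⊕ c = fromℕ< (m%n<n (toℕ u + c) N)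

  toℕ-⊕ : ∀ u c → toℕ (u ⊕ c) ≡ (toℕ u + c) % N
  toℕ-⊕ u c = toℕ-fromℕ< (m%n<n (toℕ u + c) N)

  diff : Fin N → Fin N → ℕ
  diff u v = (toℕ v + (N ∸ toℕ u)) % N

  ⊕-⊕ : ∀ u a b → u ⊕ a ⊕ b ≡ u ⊕ (a + b)
  ⊕-⊕ u a b = toℕ-injective (begin
    toℕ (u ⊕ a ⊕ b)          ≡⟨ toℕ-⊕ (u ⊕ a) b ⟩
    (toℕ (u ⊕ a) + b) % N    ≡⟨ cong (λ x → (x + b) % N) (toℕ-⊕ u a) ⟩
    ((toℕ u + a) % N + b) % N ≡⟨ [m%o+n]%o≡[m+n]%o (toℕ u + a) b N ⟩
    (toℕ u + a + b) % N      ≡⟨ cong (_% N) (+-assoc (toℕ u) a b) ⟩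
    (toℕ u + (a + b)) % N    ≡⟨ toℕ-⊕ u (a + b) ⟨
    toℕ (u ⊕ (a + b))        ∎)

  ⊕-identityʳ : ∀ u → u ⊕ 0 ≡ u
  ⊕-identityʳ u = toℕ-injective (begin
    toℕ (u ⊕ 0)      ≡⟨ toℕ-⊕ u 0 ⟩
    (toℕ u + 0) % N  ≡⟨ cong (_% N) (+-identityʳ (toℕ u)) ⟩
    toℕ u % N        ≡⟨ m<n⇒m%n≡m (toℕ<n u) ⟩
    toℕ u            ∎)

  ⊕-period : ∀ u → u ⊕ N ≡ u
  ⊕-period u = toℕ-injective (begin
    toℕ (u ⊕ N)      ≡⟨ toℕ-⊕ u N ⟩
    (toℕ u + N) % N  ≡⟨ [m+n]%n≡m%n (toℕ u) N ⟩
    toℕ u % N        ≡⟨ m<n⇒m%n≡m (toℕ<n u) ⟩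
    toℕ u            ∎)

  ⊕-injective : ∀ c → c ≤ N → Injective _≡_ _≡_ (_⊕ c)
  ⊕-injective c c≤N {u} {v} eq = begin
    u                   ≡⟨ ⊕-period u ⟨
    u ⊕ N               ≡⟨ cong (u ⊕_) (m+[n∸m]≡n c≤N) ⟨
    u ⊕ (c + (N ∸ c))   ≡⟨ ⊕-⊕ u c (N ∸ c) ⟨
    u ⊕ c ⊕ (N ∸ c)     ≡⟨ cong (_⊕ (N ∸ c)) eq ⟩
    v ⊕ c ⊕ (N ∸ c)     ≡⟨ ⊕-⊕ v c (N ∸ c) ⟩
    v ⊕ (c + (N ∸ c))   ≡⟨ cong (v ⊕_) (m+[n∸m]≡n c≤N) ⟩
    v ⊕ N               ≡⟨ ⊕-period v ⟩
    v                   ∎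

  ⊕-diff : ∀ u v → u ⊕ diff u v ≡ v
  ⊕-diff u v = toℕ-injective (begin
    toℕ (u ⊕ diff u v)                   ≡⟨ toℕ-⊕ u (diff u v) ⟩
    (x + (y + (N ∸ x)) % N) % N          ≡⟨ [m+n%o]%o≡[m+n]%o x (y + (N ∸ x)) N ⟩
    (x + (y + (N ∸ x))) % N              ≡⟨ cong (_% N) (x+[y+[N∸x]]≡y+N (toℕ<n u)) ⟩
    (y + N) % N                          ≡⟨ [m+n]%n≡m%n y N ⟩
    y % N                                ≡⟨ m<n⇒m%n≡m (toℕ<n v) ⟩
    y                                    ∎)
    where
    x = toℕ u
    y = toℕ v
    x+[y+[N∸x]]≡y+N : ∀ {x y} → x < N → x + (y + (N ∸ x)) ≡ y + N
    x+[y+[N∸x]]≡y+N {x} {y} x<N = begin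
      x + (y + (N ∸ x)) ≡⟨ cong (x +_) (+-comm y (N ∸ x)) ⟩
      x + ((N ∸ x) + y) ≡⟨ +-assoc x (N ∸ x) y ⟨
      x + (N ∸ x) + y   ≡⟨ cong (_+ y) (m+[n∸m]≡n (<⇒≤ x<N)) ⟩
      N + y             ≡⟨ +-comm N y ⟩
      y + N             ∎

  diff-⊕ : ∀ u c → c < N → diff u (u ⊕ c) ≡ c
  diff-⊕ u c c<N = begin
    (toℕ (u ⊕ c) + (N ∸ x)) % N   ≡⟨ cong (λ z → (z + (N ∸ x)) % N) (toℕ-⊕ u c) ⟩
    ((x + c) % N + (N ∸ x)) % N   ≡⟨ [m%o+n]%o≡[m+n]%o (x + c) (N ∸ x) N ⟩
    (x + c + (N ∸ x)) % N         ≡⟨ cong (_% N) x+c+[N∸x]≡c+N ⟩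
    (c + N) % N                   ≡⟨ [m+n]%n≡m%n c N ⟩
    c % N                         ≡⟨ m<n⇒m%n≡m c<N ⟩
    c                             ∎
    where
    x = toℕ u
    x+c+[N∸x]≡c+N : x + c + (N ∸ x) ≡ c + N
    x+c+[N∸x]≡c+N = begin
      x + c + (N ∸ x)   ≡⟨ cong (_+ (N ∸ x)) (+-comm x c) ⟩
      c + x + (N ∸ x)   ≡⟨ +-assoc c x (N ∸ x) ⟩
      c + (x + (N ∸ x)) ≡⟨ cong (c +_) (m+[n∸m]≡n (<⇒≤ (toℕ<n u))) ⟩
      c + N             ∎

  diff≡⇒⊕ : ∀ {u v c} → diff u v ≡ c → v ≡ u ⊕ c
  diff≡⇒⊕ {u} {v} refl = sym (⊕-diff u v)

  diff-self : ∀ u → diff u u ≡ 0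
  diff-self u = trans (cong (diff u) (sym (⊕-identityʳ u))) (diff-⊕ u 0 (>-nonZero⁻¹ N))

  parity-⊕ : parity N ≡ 0ℙ → ∀ u c → parity (toℕ (u ⊕ c)) ≡ parity (toℕ u) ℙ.+ parity c
  parity-⊕ even u c = begin
    parity (toℕ (u ⊕ c))         ≡⟨ cong parity (toℕ-⊕ u c) ⟩
    parity ((toℕ u + c) % N)     ≡⟨ parity-% (toℕ u + c) N even ⟩
    parity (toℕ u + c)           ≡⟨ ℙ.+-homo-+ (toℕ u) c ⟩
    parity (toℕ u) ℙ.+ parity c  ∎

module ComplementaryLabeling (N c₁ c₃ : ℕ) .{{_ : NonZero N}}
    (N-even : parity N ≡ 0ℙ) (c₁-odd : parity c₁ ≡ 1ℙ) (c₃-odd : parity c₃ ≡ 1ℙ)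
    (c₁+c₃≡N : c₁ + c₃ ≡ N) where

  open CyclicShift N

  parity-⊕-odd : ∀ {c} → parity c ≡ 1ℙ → ∀ u → parity (toℕ (u ⊕ c)) ≡ parity (toℕ u) ⁻¹
  parity-⊕-odd {c} c-odd u = begin
    parity (toℕ (u ⊕ c))          ≡⟨ parity-⊕ N-even u c ⟩
    parity (toℕ u) ℙ.+ parity c   ≡⟨ cong (parity (toℕ u) ℙ.+_) c-odd ⟩
    parity (toℕ u) ℙ.+ 1ℙ         ≡⟨ ℙ.+-comm (parity (toℕ u)) 1ℙ ⟩
    parity (toℕ u) ⁻¹             ∎

  ⊕-c₁-c₃ : ∀ u → u ⊕ c₁ ⊕ c₃ ≡ u
  ⊕-c₁-c₃ u = trans (⊕-⊕ u c₁ c₃) (trans (cong (u ⊕_) c₁+c₃≡N) (⊕-period u))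

  ⊕-c₃-c₁ : ∀ u → u ⊕ c₃ ⊕ c₁ ≡ u
  ⊕-c₃-c₁ u = trans (⊕-⊕ u c₃ c₁) (trans (cong (u ⊕_) (trans (+-comm c₃ c₁) c₁+c₃≡N)) (⊕-period u))

  labelBy : Parity → Fin N → Fin N
  labelBy 0ℙ y = y
  labelBy 1ℙ y = opposite (y ⊕ c₁)

  ℓ : Fin N → Fin N
  ℓ y = labelBy (parity (toℕ y)) y

  ℓ-even : ∀ {y} → parity (toℕ y) ≡ 0ℙ → ℓ y ≡ y
  ℓ-even {y} even rewrite even = refl

  ℓ-odd : ∀ {y} → parity (toℕ y) ≡ 1ℙ → ℓ y ≡ opposite (y ⊕ c₁)
  ℓ-odd {y} odd rewrite odd = refl

  parity-ℓ : ∀ y → parity (toℕ (ℓ y)) ≡ parity (toℕ y)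
  parity-ℓ y with parity (toℕ y) in eq
  ... | 0ℙ = eq
  ... | 1ℙ = begin
    parity (toℕ (opposite (y ⊕ c₁)))  ≡⟨ parity-opposite N-even (y ⊕ c₁) ⟩
    parity (toℕ (y ⊕ c₁)) ⁻¹          ≡⟨ cong _⁻¹ (parity-⊕-odd c₁-odd y) ⟩
    parity (toℕ y) ⁻¹ ⁻¹              ≡⟨ cong (λ p → p ⁻¹ ⁻¹) eq ⟩
    1ℙ                                ∎

  ℓ-≡⇒parity-≡ : ∀ {y y′} → ℓ y ≡ ℓ y′ → parity (toℕ y) ≡ parity (toℕ y′)
  ℓ-≡⇒parity-≡ {y} {y′} eq = trans (sym (parity-ℓ y)) (trans (cong (parity ∘ toℕ) eq) (parity-ℓ y′))

  ℓ-injective : Injective _≡_ _≡_ ℓ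
  ℓ-injective {y} {y′} eq with parity (toℕ y) in py | ℓ-≡⇒parity-≡ {y} {y′} eq
  ... | 0ℙ | same = trans (sym (ℓ-even {y} py)) (trans eq (ℓ-even {y′} (sym same)))
  ... | 1ℙ | same = ⊕-injective c₁ (subst (c₁ ≤_) c₁+c₃≡N (m≤m+n c₁ c₃)) (begin
    y ⊕ c₁                          ≡⟨ opposite-involutive (y ⊕ c₁) ⟨
    opposite (opposite (y ⊕ c₁))    ≡⟨ cong opposite (ℓ-odd {y} py) ⟨
    opposite (ℓ y)                  ≡⟨ cong opposite eq ⟩
    opposite (ℓ y′)                 ≡⟨ cong opposite (ℓ-odd {y′} (sym same)) ⟩
    opposite (opposite (y′ ⊕ c₁))   ≡⟨ opposite-involutive (y′ ⊕ c₁) ⟩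
    y′ ⊕ c₁                         ∎)

  labeling : Fin N ⤖ Fin N
  labeling = mk⤖ (ℓ-injective , strictlySurjective⇒surjective (injective⇒strictlySurjective ℓ-injective))

  ℓ-complement : ∀ {x} → parity (toℕ x) ≡ 0ℙ → suc (toℕ (ℓ x) + toℕ (ℓ (x ⊕ c₃))) ≡ N
  ℓ-complement {x} even = begin
    suc (toℕ (ℓ x) + toℕ (ℓ (x ⊕ c₃)))
      ≡⟨ cong₂ (λ a b → suc (toℕ a + toℕ b)) (ℓ-even even) (ℓ-odd x⊕c₃-odd) ⟩
    suc (toℕ x + toℕ (opposite (x ⊕ c₃ ⊕ c₁)))
      ≡⟨ cong (λ z → suc (toℕ x + toℕ (opposite z))) (⊕-c₃-c₁ x) ⟩
    suc (toℕ x + toℕ (opposite x))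
      ≡⟨ cong (λ z → suc (toℕ x + z)) (opposite-prop x) ⟩
    suc (toℕ x) + (N ∸ suc (toℕ x))
      ≡⟨ m+[n∸m]≡n (toℕ<n x) ⟩
    N ∎
    where
    x⊕c₃-odd : parity (toℕ (x ⊕ c₃)) ≡ 1ℙ
    x⊕c₃-odd = trans (parity-⊕-odd c₃-odd x) (cong _⁻¹ even)

  τ-by : Parity → Fin N → Fin N
  τ-by 0ℙ u = u ⊕ c₁
  τ-by 1ℙ u = u ⊕ c₃

  τ : Fin N → Fin N
  τ u = τ-by (parity (toℕ u)) u

  τ-even : ∀ {u} → parity (toℕ u) ≡ 0ℙ → τ u ≡ u ⊕ c₁
  τ-even {u} even rewrite even = refl

  τ-odd : ∀ {u} → parity (toℕ u) ≡ 1ℙ → τ u ≡ u ⊕ c₃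
  τ-odd {u} odd rewrite odd = refl

  τ-strictlySurjective : StrictlySurjective _≡_ τ
  τ-strictlySurjective v with parity (toℕ v) in pv
  ... | 0ℙ = v ⊕ c₁ , trans (τ-odd (trans (parity-⊕-odd c₁-odd v) (cong _⁻¹ pv))) (⊕-c₁-c₃ v)
  ... | 1ℙ = v ⊕ c₃ , trans (τ-even (trans (parity-⊕-odd c₃-odd v) (cong _⁻¹ pv))) (⊕-c₃-c₁ v)

  tripleSum : Fin N → ℕ
  tripleSum u = toℕ (ℓ u) + toℕ (ℓ (u ⊕ c₁)) + toℕ (ℓ (u ⊕ c₃))

  tripleSum-τ : ∀ u → suc (tripleSum u) ≡ N + toℕ (ℓ (τ u))
  tripleSum-τ u = [ even-case , odd-case ]′ (parity-cases (toℕ u))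
    where
    a = toℕ (ℓ u)
    b = toℕ (ℓ (u ⊕ c₁))
    c = toℕ (ℓ (u ⊕ c₃))
    even-case : parity (toℕ u) ≡ 0ℙ → suc (a + b + c) ≡ N + toℕ (ℓ (τ u))
    even-case pu = begin
      suc (a + b + c)   ≡⟨ regroup a b c ⟩
      suc (a + c) + b   ≡⟨ cong (_+ b) (ℓ-complement pu) ⟩
      N + b             ≡⟨ cong (λ z → N + toℕ (ℓ z)) (τ-even pu) ⟨
      N + toℕ (ℓ (τ u)) ∎
      where
      regroup : ∀ a b c → suc (a + b + c) ≡ suc (a + c) + b
      regroup = solve-∀
    odd-case : parity (toℕ u) ≡ 1ℙ → suc (a + b + c) ≡ N + toℕ (ℓ (τ u))
    odd-case pu = begin
      suc (a + b + c)                      ≡⟨ regroup a b c ⟩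
      suc (b + a) + c                      ≡⟨ cong (λ z → suc (b + toℕ (ℓ z)) + c) (⊕-c₁-c₃ u) ⟨
      suc (b + toℕ (ℓ (u ⊕ c₁ ⊕ c₃))) + c  ≡⟨ cong (_+ c) (ℓ-complement u⊕c₁-even) ⟩
      N + c                                ≡⟨ cong (λ z → N + toℕ (ℓ z)) (τ-odd pu) ⟨
      N + toℕ (ℓ (τ u))                    ∎
      where
      u⊕c₁-even = trans (parity-⊕-odd c₁-odd u) (cong _⁻¹ pu)
      regroup : ∀ a b c → suc (a + b + c) ≡ suc (b + a) + c
      regroup = solve-∀

≡ᵇ-true : ∀ {m n} → m ≡ n → (m ≡ᵇ n) ≡ true
≡ᵇ-true {m} {n} = dec-true (m ≟ n)

≡ᵇ-false : ∀ {m n} → m ≢ n → (m ≡ᵇ n) ≡ false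
≡ᵇ-false {m} {n} = dec-false (m ≟ n)

≤ᵇ-true : ∀ {m n} → m ≤ n → (m ≤ᵇ n) ≡ true
≤ᵇ-true {m} {n} = dec-true (m ≤? n)

≤ᵇ-false : ∀ {m n} → ¬ m ≤ n → (m ≤ᵇ n) ≡ false
≤ᵇ-false {m} {n} = dec-false (m ≤? n)

+-<-distinct : ∀ {p q m} → p ≤ m → q ≤ m → p ≢ q → p + q < m + m
+-<-distinct {p} {q} {m} p≤m q≤m p≢q with m≤n⇒m<n∨m≡n p≤m
... | inj₁ p<m  = +-mono-<-≤ p<m q≤m
... | inj₂ refl = +-monoʳ-< p (≤∧≢⇒< q≤m (p≢q ∘ sym))

progression-identity : ∀ m P C d → 2 * P + suc m ≡ suc m * suc m →
  (suc m + P) + (suc m + P) + (suc m + P) + P * d ≡ suc m * C → 6 + (3 + d) * m ≡ 2 * C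
progression-identity m P C d gauss total = *-cancelˡ-≡ _ _ (suc m) (begin
  suc m * (6 + (3 + d) * m)               ≡⟨ expand m d ⟩
  6 * suc m + (3 + d) * (suc m * m)       ≡⟨ cong (λ x → 6 * suc m + (3 + d) * x) twiceP ⟩
  6 * suc m + (3 + d) * (2 * P)           ≡⟨ collect m P d ⟩
  2 * ((suc m + P) + (suc m + P) + (suc m + P) + P * d) ≡⟨ cong (2 *_) total ⟩
  2 * (suc m * C)                         ≡⟨ shuffle m C ⟩
  suc m * (2 * C)                         ∎)
  where
  twiceP : suc m * m ≡ 2 * P
  twiceP = +-cancelʳ-≡ (suc m) (suc m * m) (2 * P) (begin
    suc m * m + suc m ≡⟨ square m ⟩
    suc m * suc m     ≡⟨ gauss ⟨
    2 * P + suc m     ∎)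
    where
    square : ∀ m → suc m * m + suc m ≡ suc m * suc m
    square = solve-∀
  expand : ∀ m d → suc m * (6 + (3 + d) * m) ≡ 6 * suc m + (3 + d) * (suc m * m)
  expand = solve-∀
  collect : ∀ m P d → 6 * suc m + (3 + d) * (2 * P) ≡ 2 * ((suc m + P) + (suc m + P) + (suc m + P) + P * d)
  collect = solve-∀
  shuffle : ∀ m C → 2 * (suc m * C) ≡ suc m * (2 * C)
  shuffle = solve-∀

even-progression-impossible : ∀ n e C → 6 + (3 + 2 * e) * (4 * n + 3) ≢ 2 * C
even-progression-impossible n e C eq = even≢odd C (6 * n + 7 + e * (4 * n + 3)) (trans (sym eq) (odd n e))
  where
  odd : ∀ n e → 6 + (3 + 2 * e) * (4 * n + 3) ≡ suc (2 * (6 * n + 7 + e * (4 * n + 3)))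
  odd = solve-∀

odd-below-3 : ∀ d → (∀ e → d ≢ 2 * e) → d < 3 → d ≡ 1
odd-below-3 0 odd _ = ⊥-elim (odd 0 refl)
odd-below-3 1 _ _ = refl
odd-below-3 2 odd _ = ⊥-elim (odd 1 refl)
odd-below-3 (suc (suc (suc d))) _ (s≤s (s≤s (s≤s ())))

module Harary (n : ℕ) where

  N c₁ c₃ : ℕ
  N = order n
  c₁ = 2 * n + 1
  c₃ = 2 * n + 3

  open CyclicShift N

  adjacentOffset : ℕ → Bool
  adjacentOffset t = not (t ≡ᵇ 0) ∧ ((t ≤ᵇ 2 * n) ∨ ((2 * n + 4) ≤ᵇ t) ∨ (t ≡ᵇ (2 * n + 2)))

  pick : ℕ → ℕ → ℕ → ℕ
  pick t c x = if t ≡ᵇ c then x else 0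

  c₁≢0 : c₁ ≢ 0
  c₁≢0 = m+1+n≢0 (2 * n)

  c₃≢0 : c₃ ≢ 0
  c₃≢0 = m+1+n≢0 (2 * n)

  c₁+c₃≡N : c₁ + c₃ ≡ N
  c₁+c₃≡N = sum-of-offsets n
    where
    sum-of-offsets : ∀ n → 2 * n + 1 + (2 * n + 3) ≡ suc (4 * n + 3)
    sum-of-offsets = solve-∀

  pick-≢ : ∀ {t c} x → t ≢ c → pick t c x ≡ 0
  pick-≢ x t≢c rewrite ≡ᵇ-false t≢c = refl

  pick-≡ : ∀ {t c} x → t ≡ c → pick t c x ≡ x
  pick-≡ x t≡c rewrite ≡ᵇ-true t≡c = refl

  private
    2n+-≢ : ∀ {j k} → j ≢ k → 2 * n + j ≢ 2 * n + k
    2n+-≢ j≢k eq = j≢k (+-cancelˡ-≡ (2 * n) _ _ eq)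

    2n+-≱ : ∀ {j k} → j < k → ¬ 2 * n + k ≤ 2 * n + j
    2n+-≱ j<k = <⇒≱ (+-monoʳ-< (2 * n) j<k)

    2n+-step : ∀ {k t} → 2 * n + k ≤ t → t ≢ 2 * n + k → 2 * n + suc k ≤ t
    2n+-step {k} {t} le ne = subst (_≤ t) (sym (+-suc (2 * n) k)) (≤∧≢⇒< le (ne ∘ sym))

    2n+4≤ : ∀ {t} → ¬ t ≤ 2 * n → t ≢ 2 * n + 1 → t ≢ 2 * n + 2 → t ≢ 2 * n + 3 → 2 * n + 4 ≤ t
    2n+4≤ {t} t≰2n t≢1 t≢2 t≢3 =
      2n+-step (2n+-step (2n+-step (subst (_≤ t) (+-comm 1 (2 * n)) (≰⇒> t≰2n)) t≢1) t≢2) t≢3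

  adjacentOffset-c₁ : adjacentOffset c₁ ≡ false
  adjacentOffset-c₁
    rewrite ≡ᵇ-false c₁≢0 | ≤ᵇ-false (m+1+n≰m (2 * n) {0}) | ≤ᵇ-false (2n+-≱ {1} {4} (s≤s (s≤s z≤n)))
          | ≡ᵇ-false (2n+-≢ {1} {2} λ ()) = refl

  adjacentOffset-c₃ : adjacentOffset c₃ ≡ false
  adjacentOffset-c₃
    rewrite ≡ᵇ-false c₃≢0 | ≤ᵇ-false (m+1+n≰m (2 * n) {2}) | ≤ᵇ-false (2n+-≱ {3} {4} ≤-refl)
          | ≡ᵇ-false (2n+-≢ {3} {2} λ ()) = refl

  adjacentOffset-true : ∀ {t} → t ≢ 0 → t ≢ c₁ → t ≢ c₃ → adjacentOffset t ≡ true
  adjacentOffset-true {t} t≢0 t≢c₁ t≢c₃ rewrite ≡ᵇ-false t≢0 with t ≤? 2 * n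
  ... | yes t≤2n rewrite ≤ᵇ-true t≤2n = refl
  ... | no t≰2n with t ≟ 2 * n + 2
  ...   | yes refl rewrite ≤ᵇ-false t≰2n | ≡ᵇ-true {2 * n + 2} refl = ∨-zeroʳ _
  ...   | no t≢2n+2 rewrite ≤ᵇ-false t≰2n | ≤ᵇ-true (2n+4≤ t≰2n t≢c₁ t≢2n+2 t≢c₃) = refl

  split-at-offset : ∀ t x → (if adjacentOffset t then x else 0) + pick t 0 x + pick t c₁ x + pick t c₃ x ≡ x
  split-at-offset t x with t ≟ 0 | t ≟ c₁ | t ≟ c₃
  ... | yes refl | _ | _ rewrite ≡ᵇ-false (c₁≢0 ∘ sym) | ≡ᵇ-false (c₃≢0 ∘ sym) =
    trans (+-identityʳ (x + 0)) (+-identityʳ x)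
  ... | no t≢0 | yes refl | _ rewrite adjacentOffset-c₁ | ≡ᵇ-false c₁≢0 | ≡ᵇ-true {c₁} refl
                                   | ≡ᵇ-false (2n+-≢ {1} {3} λ ()) = +-identityʳ x
  ... | no t≢0 | no t≢c₁ | yes refl rewrite adjacentOffset-c₃ | ≡ᵇ-false c₃≢0
                                   | ≡ᵇ-false (2n+-≢ {3} {1} λ ()) | ≡ᵇ-true {c₃} refl = refl
  ... | no t≢0 | no t≢c₁ | no t≢c₃ rewrite adjacentOffset-true t≢0 t≢c₁ t≢c₃ | ≡ᵇ-false t≢0
                                   | ≡ᵇ-false t≢c₁ | ≡ᵇ-false t≢c₃ = +0+0+0 x
    where
    +0+0+0 : ∀ x → x + 0 + 0 + 0 ≡ x
    +0+0+0 = solve-∀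

  c₁<N : c₁ < N
  c₁<N = subst (c₁ <_) c₁+c₃≡N (m<m+n c₁ (n≢0⇒n>0 c₃≢0))

  c₃<N : c₃ < N
  c₃<N = subst (c₃ <_) c₁+c₃≡N (m<n+m c₃ (n≢0⇒n>0 c₁≢0))

  nonNeighbourSum : Labeling n → Fin N → ℕ
  nonNeighbourSum f u = label n f u + label n f (u ⊕ c₁) + label n f (u ⊕ c₃)

  labelSum : Labeling n → ℕ
  labelSum f = ∑[ v < N ] label n f v

  ∑-pick : ∀ (f : Labeling n) u c → c < N → ∑[ v < N ] pick (diff u v) c (label n f v) ≡ label n f (u ⊕ c)
  ∑-pick f u c c<N = trans (∑-single (u ⊕ c) _ elsewhere-zero) at-u⊕c
    where
    elsewhere-zero : ∀ v → v ≢ u ⊕ c → pick (diff u v) c (label n f v) ≡ 0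
    elsewhere-zero v v≢u⊕c = pick-≢ (label n f v) (v≢u⊕c ∘ diff≡⇒⊕ {u})
    at-u⊕c : pick (diff u (u ⊕ c)) c (label n f (u ⊕ c)) ≡ label n f (u ⊕ c)
    at-u⊕c = pick-≡ (label n f (u ⊕ c)) (diff-⊕ u c c<N)

  weight+nonNeighbourSum : ∀ f u → weight n f u + nonNeighbourSum f u ≡ labelSum f
  weight+nonNeighbourSum f u = begin
    weight n f u + (L u + L (u ⊕ c₁) + L (u ⊕ c₃))
      ≡⟨ cong₂ (λ w x → w + (x + L (u ⊕ c₁) + L (u ⊕ c₃))) (sum-map-allFin A) (cong L (sym (⊕-identityʳ u))) ⟩
    sum A + (L (u ⊕ 0) + L (u ⊕ c₁) + L (u ⊕ c₃))
      ≡⟨ cong₂ (λ x y → sum A + (x + y + L (u ⊕ c₃))) (∑-pick f u 0 (>-nonZero⁻¹ N)) (∑-pick f u c₁ c₁<N) ⟨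
    sum A + (sum (P 0) + sum (P c₁) + L (u ⊕ c₃))
      ≡⟨ cong (λ z → sum A + (sum (P 0) + sum (P c₁) + z)) (∑-pick f u c₃ c₃<N) ⟨
    sum A + (sum (P 0) + sum (P c₁) + sum (P c₃))
      ≡⟨ regroup (sum A) (sum (P 0)) (sum (P c₁)) (sum (P c₃)) ⟩
    sum A + sum (P 0) + sum (P c₁) + sum (P c₃)
      ≡⟨ cong (λ s → s + sum (P c₁) + sum (P c₃)) (∑-distrib-+ A (P 0)) ⟨
    sum (λ v → A v + P 0 v) + sum (P c₁) + sum (P c₃)
      ≡⟨ cong (_+ sum (P c₃)) (∑-distrib-+ (λ v → A v + P 0 v) (P c₁)) ⟨
    sum (λ v → A v + P 0 v + P c₁ v) + sum (P c₃)
      ≡⟨ ∑-distrib-+ (λ v → A v + P 0 v + P c₁ v) (P c₃) ⟨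
    sum (λ v → A v + P 0 v + P c₁ v + P c₃ v)
      ≡⟨ sum-cong-≗ {N} (λ v → split-at-offset (diff u v) (L v)) ⟩
    labelSum f ∎
    where
    L = label n f
    A : Fin N → ℕ
    A v = if adjᵇ n u v then L v else 0
    P : ℕ → Fin N → ℕ
    P c v = pick (diff u v) c (L v)
    regroup : ∀ a b c d → a + (b + c + d) ≡ a + b + c + d
    regroup = solve-∀

  label-injective : ∀ (f : Labeling n) {u v} → label n f u ≡ label n f v → u ≡ v
  label-injective f eq = Bijection.injective f (toℕ-injective (suc-injective eq))

  labelSum≡N+∑toℕ : ∀ f → labelSum f ≡ N + ∑[ k < N ] toℕ k
  labelSum≡N+∑toℕ f = begin
    ∑[ v < N ] suc (toℕ (Bijection.to f v))  ≡⟨ ∑-reindex (Bijection.injective f) (suc ∘ toℕ) ⟩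
    ∑[ k < N ] (1 + toℕ k)                   ≡⟨ ∑-distrib-+ {N} (λ _ → 1) toℕ ⟩
    ∑[ k < N ] 1 + ∑[ k < N ] toℕ k          ≡⟨ cong (_+ ∑[ k < N ] toℕ k) (∑-const N 1) ⟩
    N * 1 + ∑[ k < N ] toℕ k                 ≡⟨ cong (_+ ∑[ k < N ] toℕ k) (*-identityʳ N) ⟩
    N + ∑[ k < N ] toℕ k                     ∎

  ∑-label-⊕ : ∀ f c → c < N → ∑[ u < N ] label n f (u ⊕ c) ≡ labelSum f
  ∑-label-⊕ f c c<N = ∑-reindex (⊕-injective c (<⇒≤ c<N)) (label n f)

  ∑-nonNeighbourSum : ∀ f → ∑[ u < N ] nonNeighbourSum f u ≡ labelSum f + labelSum f + labelSum f
  ∑-nonNeighbourSum f = begin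
    ∑[ u < N ] (L u + L (u ⊕ c₁) + L (u ⊕ c₃))
      ≡⟨ ∑-distrib-+ (λ u → L u + L (u ⊕ c₁)) (λ u → L (u ⊕ c₃)) ⟩
    ∑[ u < N ] (L u + L (u ⊕ c₁)) + ∑[ u < N ] L (u ⊕ c₃)
      ≡⟨ cong (_+ ∑[ u < N ] L (u ⊕ c₃)) (∑-distrib-+ L (λ u → L (u ⊕ c₁))) ⟩
    labelSum f + ∑[ u < N ] L (u ⊕ c₁) + ∑[ u < N ] L (u ⊕ c₃)
      ≡⟨ cong₂ (λ x y → labelSum f + x + y) (∑-label-⊕ f c₁ c₁<N) (∑-label-⊕ f c₃ c₃<N) ⟩
    labelSum f + labelSum f + labelSum f ∎
    where
    L = label n f

  nonNeighbourSum-bounds : ∀ f u → 3 ≤ nonNeighbourSum f u × nonNeighbourSum f u < N + N + N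
  nonNeighbourSum-bounds f u =
    +-mono-≤ (+-mono-≤ (s≤s z≤n) (s≤s z≤n)) (s≤s z≤n) ,
    +-mono-<-≤ (+-<-distinct (label≤N u) (label≤N (u ⊕ c₁)) u≢u⊕c₁) (label≤N (u ⊕ c₃))
    where
    label≤N : ∀ v → label n f v ≤ N
    label≤N v = toℕ<n (Bijection.to f v)
    u≢u⊕c₁ : label n f u ≢ label n f (u ⊕ c₁)
    u≢u⊕c₁ eq = c₁≢0 (begin
      c₁               ≡⟨ diff-⊕ u c₁ c₁<N ⟨
      diff u (u ⊕ c₁)  ≡⟨ cong (diff u) (label-injective f eq) ⟨
      diff u u         ≡⟨ diff-self u ⟩
      0                ∎)

  weight≡⇒nonNeighbourSum≡ : ∀ f {u v} → weight n f u ≡ weight n f v → nonNeighbourSum f u ≡ nonNeighbourSum f v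
  weight≡⇒nonNeighbourSum≡ f {u} {v} eq = +-cancelˡ-≡ (weight n f u) _ _ (begin
    weight n f u + nonNeighbourSum f u ≡⟨ weight+nonNeighbourSum f u ⟩
    labelSum f                         ≡⟨ weight+nonNeighbourSum f v ⟨
    weight n f v + nonNeighbourSum f v ≡⟨ cong (_+ nonNeighbourSum f v) eq ⟨
    weight n f u + nonNeighbourSum f v ∎)

  module Necessity (f : Labeling n) (A d : ℕ)
      (weight-index : ∀ u → ∃ λ (k : Fin N) → weight n f u ≡ A + toℕ k * d)
      (index-weight : ∀ (k : Fin N) → ∃ λ u → weight n f u ≡ A + toℕ k * d) where

    ρ : Fin N → Fin N
    ρ k = proj₁ (index-weight k)

    C : ℕ
    C = nonNeighbourSum f (ρ Fin.zero)

    nonNeighbourSum-ρ : ∀ k → nonNeighbourSum f (ρ k) + toℕ k * d ≡ C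
    nonNeighbourSum-ρ k = +-cancelˡ-≡ A _ _ (begin
      A + (nonNeighbourSum f (ρ k) + toℕ k * d) ≡⟨ swap A (nonNeighbourSum f (ρ k)) (toℕ k * d) ⟩
      (A + toℕ k * d) + nonNeighbourSum f (ρ k) ≡⟨ cong (_+ nonNeighbourSum f (ρ k)) (proj₂ (index-weight k)) ⟨
      weight n f (ρ k) + nonNeighbourSum f (ρ k) ≡⟨ weight+nonNeighbourSum f (ρ k) ⟩
      labelSum f                                 ≡⟨ weight+nonNeighbourSum f (ρ Fin.zero) ⟨
      weight n f (ρ Fin.zero) + C                ≡⟨ cong (_+ C) (proj₂ (index-weight Fin.zero)) ⟩
      A + 0 + C                                  ≡⟨ cong (_+ C) (+-identityʳ A) ⟩
      A + C                                      ∎)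
      where
      swap : ∀ a b c → a + (b + c) ≡ a + c + b
      swap = solve-∀

    ∑-nonNeighbourSum-progression : ∑[ u < N ] nonNeighbourSum f u + (∑[ k < N ] toℕ k) * d ≡ N * C
    ∑-nonNeighbourSum-progression with d ≟ 0
    -- For d = 0 the map ρ need not be injective, but then all weights are equal.
    ... | yes refl = begin
      ∑[ u < N ] nonNeighbourSum f u + (∑[ k < N ] toℕ k) * 0
        ≡⟨ cong₂ _+_ (sum-cong-≗ {N} constant) (*-zeroʳ (∑[ k < N ] toℕ k)) ⟩
      ∑[ u < N ] C + 0
        ≡⟨ +-identityʳ _ ⟩
      ∑[ u < N ] C
        ≡⟨ ∑-const N C ⟩
      N * C ∎
      where
      constant : ∀ u → nonNeighbourSum f u ≡ C
      constant u = weight≡⇒nonNeighbourSum≡ f (begin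
        weight n f u                           ≡⟨ proj₂ (weight-index u) ⟩
        A + toℕ (proj₁ (weight-index u)) * 0   ≡⟨ cong (A +_) (*-zeroʳ (toℕ (proj₁ (weight-index u)))) ⟩
        A + 0                                  ≡⟨ proj₂ (index-weight Fin.zero) ⟨
        weight n f (ρ Fin.zero)                ∎)
    ... | no d≢0 = begin
      ∑[ u < N ] nonNeighbourSum f u + (∑[ k < N ] toℕ k) * d
        ≡⟨ cong₂ _+_ (∑-reindex ρ-injective (nonNeighbourSum f)) (sym (*-distribʳ-sum {N} d toℕ)) ⟨
      ∑[ k < N ] nonNeighbourSum f (ρ k) + ∑[ k < N ] (toℕ k * d)
        ≡⟨ ∑-distrib-+ (nonNeighbourSum f ∘ ρ) (λ k → toℕ k * d) ⟨
      ∑[ k < N ] (nonNeighbourSum f (ρ k) + toℕ k * d)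
        ≡⟨ sum-cong-≗ {N} nonNeighbourSum-ρ ⟩
      ∑[ k < N ] C
        ≡⟨ ∑-const N C ⟩
      N * C ∎
      where
      instance
        d-nonZero : NonZero d
        d-nonZero = ≢-nonZero d≢0
      ρ-injective : Injective _≡_ _≡_ ρ
      ρ-injective {k} {k′} eq = toℕ-injective (*-cancelʳ-≡ (toℕ k) (toℕ k′) d (+-cancelˡ-≡ A _ _ (begin
        A + toℕ k * d    ≡⟨ proj₂ (index-weight k) ⟨
        weight n f (ρ k)  ≡⟨ cong (weight n f) eq ⟩
        weight n f (ρ k′) ≡⟨ proj₂ (index-weight k′) ⟩
        A + toℕ k′ * d   ∎)))

    d-odd : ∀ e → d ≢ 2 * e
    d-odd e refl = even-progression-impossible n e C (progression-identity (4 * n + 3) P C d (∑-toℕ N) (begin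
      (N + P) + (N + P) + (N + P) + P * d ≡⟨ cong (λ s → s + s + s + P * d) (labelSum≡N+∑toℕ f) ⟨
      labelSum f + labelSum f + labelSum f + P * d ≡⟨ cong (_+ P * d) (∑-nonNeighbourSum f) ⟨
      ∑[ u < N ] nonNeighbourSum f u + P * d ≡⟨ ∑-nonNeighbourSum-progression ⟩
      N * C ∎))
      where
      P = ∑[ k < N ] toℕ k

    d<3 : d < 3
    d<3 = ≰⇒> λ 3≤d → <-irrefl 3N≡N+N+N (≤-<-trans (lower 3≤d) (proj₂ (nonNeighbourSum-bounds f (ρ Fin.zero))))
      where
      last : Fin N
      last = Fin.fromℕ (4 * n + 3)
      3N≡N+N+N : 3 + (4 * n + 3) * 3 ≡ N + N + N
      3N≡N+N+N = thrice n
        where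
        thrice : ∀ n → 3 + (4 * n + 3) * 3 ≡ suc (4 * n + 3) + suc (4 * n + 3) + suc (4 * n + 3)
        thrice = solve-∀
      lower : 3 ≤ d → 3 + (4 * n + 3) * 3 ≤ C
      lower 3≤d = subst (3 + (4 * n + 3) * 3 ≤_)
        (trans (cong (λ x → nonNeighbourSum f (ρ last) + x * d) (sym (toℕ-fromℕ (4 * n + 3)))) (nonNeighbourSum-ρ last))
        (+-mono-≤ (proj₁ (nonNeighbourSum-bounds f (ρ last))) (*-monoʳ-≤ (4 * n + 3) 3≤d))

  necessity : ∀ a d → HararyDistAntimagic n a d → d ≡ 1
  necessity a d (f , antimagic) with Equivalence.from (antimagic a) (Fin.zero , sym (ℤ.+-identityʳ a))
  ... | u₀ , refl = odd-below-3 d P.d-odd P.d<3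
    where
    weight-index : ∀ u → ∃ λ (k : Fin N) → weight n f u ≡ weight n f u₀ + toℕ k * d
    weight-index u with Equivalence.to (antimagic (ℤ.+ weight n f u)) (u , refl)
    ... | k , eq = k , ℤ.+-injective eq
    index-weight : ∀ (k : Fin N) → ∃ λ u → weight n f u ≡ weight n f u₀ + toℕ k * d
    index-weight k with Equivalence.from (antimagic (ℤ.+ (weight n f u₀ + toℕ k * d))) (k , refl)
    ... | u , eq = u , ℤ.+-injective eq
    module P = Necessity f (weight n f u₀) d weight-index index-weight

  N-even : parity N ≡ 0ℙ
  N-even = trans (cong parity (double n)) (ℙ.*-homo-* 2 (2 * n + 2))
    where
    double : ∀ n → suc (4 * n + 3) ≡ 2 * (2 * n + 2)
    double = solve-∀

  open ComplementaryLabeling N c₁ c₃ N-even (parity-2*+ n 1) (parity-2*+ n 3) c₁+c₃≡N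

  κ : Fin N → Fin N
  κ u = opposite (ℓ (τ u))

  κ-strictlySurjective : StrictlySurjective _≡_ κ
  κ-strictlySurjective k = u , (begin
    opposite (ℓ (τ u)) ≡⟨ cong (opposite ∘ ℓ) (proj₂ (τ-strictlySurjective v)) ⟩
    opposite (ℓ v)     ≡⟨ cong opposite (proj₂ (injective⇒strictlySurjective ℓ-injective (opposite k))) ⟩
    opposite (opposite k) ≡⟨ opposite-involutive k ⟩
    k ∎)
    where
    v = proj₁ (injective⇒strictlySurjective ℓ-injective (opposite k))
    u = proj₁ (τ-strictlySurjective v)

  nonNeighbourSum-κ : ∀ u → nonNeighbourSum labeling u + toℕ (κ u) ≡ suc (N + N)
  nonNeighbourSum-κ u = begin
    suc a + suc b + suc c + toℕ (opposite (ℓ (τ u)))  ≡⟨ cong₂ _+_ (three a b c) (opposite-prop (ℓ (τ u))) ⟩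
    suc (suc (suc (tripleSum u))) + (N ∸ suc t)       ≡⟨ cong (λ w → suc (suc w) + (N ∸ suc t)) (tripleSum-τ u) ⟩
    suc (suc (N + t)) + (N ∸ suc t)                   ≡⟨ regroup N t (N ∸ suc t) ⟩
    suc (N + (suc t + (N ∸ suc t)))                   ≡⟨ cong (λ x → suc (N + x)) (m+[n∸m]≡n (toℕ<n (ℓ (τ u)))) ⟩
    suc (N + N)                                       ∎
    where
    t = toℕ (ℓ (τ u))
    a = toℕ (ℓ u)
    b = toℕ (ℓ (u ⊕ c₁))
    c = toℕ (ℓ (u ⊕ c₃))
    three : ∀ a b c → suc a + suc b + suc c ≡ suc (suc (suc (a + b + c)))
    three = solve-∀
    regroup : ∀ N t r → suc (suc (N + t)) + r ≡ suc (N + (suc t + r))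
    regroup = solve-∀

  u₀ : Fin N
  u₀ = proj₁ (κ-strictlySurjective Fin.zero)

  w₀ : ℕ
  w₀ = weight n labeling u₀

  weight-κ : ∀ u → weight n labeling u ≡ w₀ + toℕ (κ u)
  weight-κ u = +-cancelʳ-≡ (T u) _ _ (begin
    weight n labeling u + T u  ≡⟨ weight+nonNeighbourSum labeling u ⟩
    labelSum labeling          ≡⟨ weight+nonNeighbourSum labeling u₀ ⟨
    w₀ + T u₀                  ≡⟨ cong (w₀ +_) (+-identityʳ (T u₀)) ⟨
    w₀ + (T u₀ + 0)            ≡⟨ cong (λ k → w₀ + (T u₀ + toℕ k)) (proj₂ (κ-strictlySurjective Fin.zero)) ⟨
    w₀ + (T u₀ + toℕ (κ u₀))   ≡⟨ cong (w₀ +_) (trans (nonNeighbourSum-κ u₀) (sym (nonNeighbourSum-κ u))) ⟩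
    w₀ + (T u + toℕ (κ u))     ≡⟨ swap w₀ (T u) (toℕ (κ u)) ⟩
    w₀ + toℕ (κ u) + T u       ∎)
    where
    T = nonNeighbourSum labeling
    swap : ∀ a b c → a + (b + c) ≡ a + c + b
    swap = solve-∀

  sufficiency : ∃ λ a → HararyDistAntimagic n a 1
  sufficiency = ℤ.+ w₀ , labeling , λ x → mk⇔ (to x) (from x)
    where
    term : Fin N → ℤ
    term k = ℤ.+ w₀ ℤ.+ ℤ.+ (toℕ k * 1)
    progression : ∀ u → ℤ.+ weight n labeling u ≡ term (κ u)
    progression u = cong ℤ.+_ (trans (weight-κ u) (cong (w₀ +_) (sym (*-identityʳ (toℕ (κ u))))))
    to : ∀ x → (∃ λ u → ℤ.+ weight n labeling u ≡ x) → ∃ λ k → x ≡ term k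
    to x (u , refl) = κ u , progression u
    from : ∀ x → (∃ λ k → x ≡ term k) → ∃ λ u → ℤ.+ weight n labeling u ≡ x
    from x (k , refl) = u , trans (progression u) (cong term κu≡k)
      where
      u = proj₁ (κ-strictlySurjective k)
      κu≡k = proj₂ (κ-strictlySurjective k)

mainTheorem12 : (m d : ℕ) →
    (∃ λ (a : ℤ) → HararyDistAntimagic (suc m) a d) ⇔ (d ≡ 1)
mainTheorem12 m d = mk⇔ (λ (a , antimagic) → Harary.necessity (suc m) a d antimagic)
                        (λ { refl → Harary.sufficiency (suc m) })
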